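{- For any $1\le k'\le k$, the output of any algorithm is at most an $O(\frac{k'}{k})$-approximate (non-randomized) composable core-set of size $k'$ for the monotone submodular maximization problem with cardinality constraint $k$.
   Context: For a finite ground set $\mathbb N$ and $f:2^{\mathbb N}\to\mathbb R_{\ge0}$, $f_k(S)=\max_{S'\subseteq S,|S'|\le k}f(S')$. An algorithm $\mathsf{ALG}$ that given any $T\subseteq\mathbb N$ returns $\mathsf{ALG}(T)\subseteq T$ with $|\mathsf{ALG}(T)|\le k'$ is an $\alpha$-approximate (non-randomized) composable core-set of size $k'$ for $f$ if for every arbitrary partition $\{T_1,\dots,T_m\}$ of $\mathbb N$, $f_k(\mathsf{ALG}(T_1)\cup\dots\cup\mathsf{ALG}(T_m))\ge\alpha f_k(T_1\cup\dots\cup T_m)$. The claim asserts that there are instances (monotone submodular $f$, with some partition) on which no algorithm achieves better than $O(k'/k)$ in this sense.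
   Formalization: The approximation factor α ranges over ℚ, and the function f takes values in the nonnegative rationals instead of $\mathbb R_{\ge0}$. -}

module Defs where

open import Data.Nat using (ℕ; zero; suc)
open import Data.Bool using (true; false; if_then_else_)
open import Data.Fin using (Fin; _≟_)
open import Data.Fin.Subset using (Subset; inside; outside; _⊆_; _∪_; _∩_; ∣_∣; ⋃; ⊤)
open import Data.Fin.Subset.Properties using (_⊆?_)
open import Data.List using (List; []; _∷_; map; foldr; filter; _++_; allFin)
open import Data.Vec using ([]; _∷_; tabulate)
open import Data.Rational using (ℚ; 0ℚ; _≤_; _+_; _⊔_)
open import Data.Product using (_×_)
open import Relation.Nullary using (does)
open import Relation.Nullary.Decidable using (_×-dec_)
import Data.Nat as ℕ

allSubsets : (n : ℕ) → List (Subset n)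
allSubsets zero = [] ∷ []
allSubsets (suc n) = map (outside ∷_) (allSubsets n) ++ map (inside ∷_) (allSubsets n)

-- f_k(S) = max { f(S') : S' ⊆ S, |S'| ≤ k }   (f ≥ 0, and S' = ∅ always qualifies)
fk : {n : ℕ} → (Subset n → ℚ) → ℕ → Subset n → ℚ
fk {n} f k S =
  foldr _⊔_ 0ℚ (map f (filter (λ S' → (S' ⊆? S) ×-dec (∣ S' ∣ ℕ.≤? k)) (allSubsets n)))

-- f : 2^N → ℝ≥0 monotone submodular (values taken in ℚ)
NonNeg : {n : ℕ} → (Subset n → ℚ) → Set
NonNeg f = ∀ A → 0ℚ ≤ f A

Monotone : {n : ℕ} → (Subset n → ℚ) → Set
Monotone f = ∀ A B → A ⊆ B → f A ≤ f B

Submodular : {n : ℕ} → (Subset n → ℚ) → Set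
Submodular f = ∀ A B → f (A ∪ B) + f (A ∩ B) ≤ f A + f B

MonotoneSubmodular : {n : ℕ} → (Subset n → ℚ) → Set
MonotoneSubmodular f = NonNeg f × Monotone f × Submodular f

Algorithm : Set
Algorithm = (n : ℕ) → (Subset n → ℚ) → Subset n → Subset n

ValidOfSize : ℕ → Algorithm → Set
ValidOfSize k' ALG = ∀ n (f : Subset n → ℚ) (T : Subset n) →
  (ALG n f T ⊆ T) × (∣ ALG n f T ∣ ℕ.≤ k')

-- the part T_i of the partition given by an assignment p : N → Fin m
part : {n m : ℕ} → (Fin n → Fin m) → Fin m → Subset n
part p i = tabulate (λ x → if does (p x ≟ i) then inside else outside)

IsApproxCoreset : ℚ → ℕ → Algorithm → Set
IsApproxCoreset α k ALG =
  ∀ n (f : Subset n → ℚ) → MonotoneSubmodular f →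
  ∀ m (p : Fin n → Fin m) →
  α Data.Rational.* fk f k ⊤ ≤ fk f k (⋃ (map (λ i → ALG n f (part p i)) (allFin m)))

module Submission where

-- Idea: one instance already forces α ≤ k'/k, so the theorem holds with
-- C = 1.  Take the ground set Fin k, the cardinality function f(S) = |S|
-- (modular, hence monotone submodular) and the trivial partition into a
-- single part T₁ = Fin k.  Then f_k(T₁) = k, while the core-set ALG(T₁)
-- has at most k' elements, so f_k(ALG(T₁)) ≤ k'.  The approximation
-- guarantee α · k ≤ f_k(ALG(T₁)) therefore gives α · k ≤ k'.

open import Defs
open import Data.Nat using (ℕ; _≤_)
open import Data.Integer using (+_)
open import Data.Rational using (ℚ; _/_; _*_)
open import Data.Product using (Σ; _×_)
import Data.Rational as ℚ

import Data.Nat as ℕ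
import Data.Nat.Properties as ℕP
import Data.Integer as ℤ
import Data.Integer.Properties as ℤP
import Data.Rational.Properties as ℚP
import Data.Nat.Coprimality as Coprimality
open import Data.Fin using (zero)
open import Data.Fin.Subset using (Subset; inside; outside; _⊆_; _∪_; _∩_; ∣_∣; ⊤; ⊥)
open import Data.Fin.Subset.Properties using (p⊆q⇒∣p∣≤∣q∣; ∣⊤∣≡n; ∪-identityʳ; _⊆?_; ⊆-refl)
open import Data.Vec using ([]; _∷_)
open import Data.List using (List; foldr; map; filter)
import Data.List as List
open import Data.List.Membership.Propositional using (_∈_)
open import Data.List.Relation.Unary.Any using (here; there)
open import Data.List.Membership.Propositional.Properties
  using (∈-map⁺; ∈-map⁻; ∈-filter⁺; ∈-filter⁻; ∈-++⁺ˡ; ∈-++⁺ʳ)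
open import Data.Product using (_,_; proj₁; proj₂)
open import Relation.Nullary.Decidable using (_×-dec_)
open import Relation.Binary.PropositionalEquality
  using (_≡_; refl; sym; trans; cong; cong₂; subst; subst₂; module ≡-Reasoning)

toℚ : ℕ → ℚ
toℚ n = + n / 1

toℚ-normal : ∀ n → toℚ n ≡ ℚ.mkℚ (+ n) 0 (Coprimality.sym (Coprimality.1-coprimeTo n))
toℚ-normal n = ℚP.normalize-coprime (Coprimality.sym (Coprimality.1-coprimeTo n))

toℚ-mono-≤ : ∀ {m n} → m ≤ n → toℚ m ℚ.≤ toℚ n
toℚ-mono-≤ {m} {n} m≤n rewrite toℚ-normal m | toℚ-normal n =
  ℚ.*≤* (subst₂ ℤ._≤_ (sym (ℤP.*-identityʳ (+ m))) (sym (ℤP.*-identityʳ (+ n))) (ℤ.+≤+ m≤n))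

toℚ-nonNeg : ∀ n → ℚ.0ℚ ℚ.≤ toℚ n
toℚ-nonNeg n = toℚ-mono-≤ (ℕ.z≤n {n})

toℚ-homo-+ : ∀ m n → toℚ m ℚ.+ toℚ n ≡ toℚ (m ℕ.+ n)
toℚ-homo-+ m n = begin
  toℚ m ℚ.+ toℚ n                                ≡⟨ cong₂ ℚ._+_ (toℚ-normal m) (toℚ-normal n) ⟩
  (+ m ℤ.* + 1 ℤ.+ + n ℤ.* + 1) / (1 ℕ.* 1)      ≡⟨ cong (_/ 1) (cong₂ ℤ._+_ (ℤP.*-identityʳ (+ m)) (ℤP.*-identityʳ (+ n))) ⟩
  toℚ (m ℕ.+ n)                                  ∎
  where open ≡-Reasoning

∣∪∣+∣∩∣ : ∀ {n} (A B : Subset n) → ∣ A ∪ B ∣ ℕ.+ ∣ A ∩ B ∣ ≡ ∣ A ∣ ℕ.+ ∣ B ∣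
∣∪∣+∣∩∣ [] [] = refl
∣∪∣+∣∩∣ (outside ∷ A) (outside ∷ B) = ∣∪∣+∣∩∣ A B
∣∪∣+∣∩∣ (outside ∷ A) (inside ∷ B) =
  trans (cong ℕ.suc (∣∪∣+∣∩∣ A B)) (sym (ℕP.+-suc ∣ A ∣ ∣ B ∣))
∣∪∣+∣∩∣ (inside ∷ A) (outside ∷ B) = cong ℕ.suc (∣∪∣+∣∩∣ A B)
∣∪∣+∣∩∣ (inside ∷ A) (inside ∷ B) = begin
  ℕ.suc (∣ A ∪ B ∣ ℕ.+ ℕ.suc ∣ A ∩ B ∣) ≡⟨ cong ℕ.suc (ℕP.+-suc ∣ A ∪ B ∣ ∣ A ∩ B ∣) ⟩
  ℕ.suc (ℕ.suc (∣ A ∪ B ∣ ℕ.+ ∣ A ∩ B ∣)) ≡⟨ cong (λ z → ℕ.suc (ℕ.suc z)) (∣∪∣+∣∩∣ A B) ⟩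
  ℕ.suc (ℕ.suc (∣ A ∣ ℕ.+ ∣ B ∣))        ≡⟨ cong ℕ.suc (ℕP.+-suc ∣ A ∣ ∣ B ∣) ⟨
  ℕ.suc (∣ A ∣ ℕ.+ ℕ.suc ∣ B ∣)          ∎
  where open ≡-Reasoning

size : ∀ {n} → Subset n → ℚ
size S = toℚ ∣ S ∣

size-nonNeg : ∀ {n} → NonNeg (size {n})
size-nonNeg A = toℚ-nonNeg ∣ A ∣

size-monotone : ∀ {n} → Monotone (size {n})
size-monotone A B A⊆B = toℚ-mono-≤ (p⊆q⇒∣p∣≤∣q∣ A⊆B)

size-modular : ∀ {n} (A B : Subset n) → size (A ∪ B) ℚ.+ size (A ∩ B) ≡ size A ℚ.+ size B
size-modular A B = begin
  size (A ∪ B) ℚ.+ size (A ∩ B)  ≡⟨ toℚ-homo-+ ∣ A ∪ B ∣ ∣ A ∩ B ∣ ⟩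
  toℚ (∣ A ∪ B ∣ ℕ.+ ∣ A ∩ B ∣)  ≡⟨ cong toℚ (∣∪∣+∣∩∣ A B) ⟩
  toℚ (∣ A ∣ ℕ.+ ∣ B ∣)          ≡⟨ toℚ-homo-+ ∣ A ∣ ∣ B ∣ ⟨
  size A ℚ.+ size B              ∎
  where open ≡-Reasoning

size-monotoneSubmodular : ∀ {n} → MonotoneSubmodular (size {n})
size-monotoneSubmodular =
  size-nonNeg , size-monotone , λ A B → ℚP.≤-reflexive (size-modular A B)

⊔-fold-lub : ∀ {x} (xs : List ℚ) → ℚ.0ℚ ℚ.≤ x → (∀ {y} → y ∈ xs → y ℚ.≤ x) →
             foldr ℚ._⊔_ ℚ.0ℚ xs ℚ.≤ x
⊔-fold-lub List.[] 0≤x bound = 0≤x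
⊔-fold-lub (y List.∷ xs) 0≤x bound =
  ℚP.⊔-lub (bound (here refl)) (⊔-fold-lub xs 0≤x (λ y∈xs → bound (there y∈xs)))

⊔-fold-ub : ∀ {y} (xs : List ℚ) → y ∈ xs → y ℚ.≤ foldr ℚ._⊔_ ℚ.0ℚ xs
⊔-fold-ub (y List.∷ xs) (here refl) = ℚP.p≤p⊔q y (foldr ℚ._⊔_ ℚ.0ℚ xs)
⊔-fold-ub (z List.∷ xs) (there y∈xs) =
  ℚP.≤-trans (⊔-fold-ub xs y∈xs) (ℚP.p≤q⊔p z (foldr ℚ._⊔_ ℚ.0ℚ xs))

∈-allSubsets : ∀ {n} (S : Subset n) → S ∈ allSubsets n
∈-allSubsets [] = here refl
∈-allSubsets (outside ∷ S) = ∈-++⁺ˡ (∈-map⁺ (outside ∷_) (∈-allSubsets S))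
∈-allSubsets (inside ∷ S) = ∈-++⁺ʳ _ (∈-map⁺ (inside ∷_) (∈-allSubsets S))

module _ {n : ℕ} (f : Subset n → ℚ) (k : ℕ) (S : Subset n) where

  private
    feasible? = λ (S' : Subset n) → (S' ⊆? S) ×-dec (∣ S' ∣ ℕ.≤? k)

  fk≤f : NonNeg f → Monotone f → fk f k S ℚ.≤ f S
  fk≤f nonNeg mono = ⊔-fold-lub _ (nonNeg S) below
    where
    below : ∀ {y} → y ∈ map f (filter feasible? (allSubsets n)) → y ℚ.≤ f S
    below y∈ with S' , S'∈ , refl ← ∈-map⁻ f y∈ =
      mono S' S (proj₁ (proj₂ (∈-filter⁻ feasible? {xs = allSubsets n} S'∈)))

  f≤fk : ∀ S' → S' ⊆ S → ∣ S' ∣ ≤ k → f S' ℚ.≤ fk f k S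
  f≤fk S' S'⊆S ∣S'∣≤k = ⊔-fold-ub _
    (∈-map⁺ f (∈-filter⁺ feasible? (∈-allSubsets S') (S'⊆S , ∣S'∣≤k)))

fk-size≤∣S∣ : ∀ {n} k (S : Subset n) → fk size k S ℚ.≤ toℚ ∣ S ∣
fk-size≤∣S∣ k S = fk≤f size k S size-nonNeg size-monotone

fk-size-⊤ : ∀ n → fk size n (⊤ {n}) ≡ toℚ n
fk-size-⊤ n = ℚP.≤-antisym upper lower
  where
  ∣⊤∣≤n : ∣ ⊤ {n} ∣ ≤ n
  ∣⊤∣≤n = ℕP.≤-reflexive (∣⊤∣≡n n)

  upper : fk size n (⊤ {n}) ℚ.≤ toℚ n
  upper = ℚP.≤-trans (fk-size≤∣S∣ n (⊤ {n})) (toℚ-mono-≤ ∣⊤∣≤n)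

  lower : toℚ n ℚ.≤ fk size n (⊤ {n})
  lower = subst (λ m → toℚ m ℚ.≤ fk size n (⊤ {n})) (∣⊤∣≡n n) (f≤fk size n (⊤ {n}) ⊤ ⊆-refl ∣⊤∣≤n)

theorem8 : Σ ℕ λ C → ∀ (k k' : ℕ) → 1 ≤ k' → k' ≤ k →
    ∀ (ALG : Algorithm) → ValidOfSize k' ALG →
    ∀ (α : ℚ) → IsApproxCoreset α k ALG →
    α * (+ k / 1) ℚ.≤ (+ C / 1) * (+ k' / 1)
theorem8 = 1 , λ k k' _ _ ALG valid α approx →
  let
      T = part {k} {1} (λ _ → zero) zero
      U = ALG k size T
      -- the guarantee on this instance; the union of core-sets is U ∪ ⊥
      guarantee : α * toℚ k ℚ.≤ fk size k (U ∪ ⊥)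
      guarantee = subst (λ v → α * v ℚ.≤ fk size k (U ∪ ⊥)) (fk-size-⊤ k)
                        (approx k size size-monotoneSubmodular 1 (λ _ → zero))
      ∣U∪⊥∣≤k' : ∣ U ∪ ⊥ ∣ ≤ k'
      ∣U∪⊥∣≤k' = subst (λ V → ∣ V ∣ ≤ k') (sym (∪-identityʳ U)) (proj₂ (valid k size T))
      coreset-small : fk size k (U ∪ ⊥) ℚ.≤ toℚ k'
      coreset-small = ℚP.≤-trans (fk-size≤∣S∣ k (U ∪ ⊥)) (toℚ-mono-≤ ∣U∪⊥∣≤k')
  in ℚP.≤-trans guarantee
       (ℚP.≤-trans coreset-small (ℚP.≤-reflexive (sym (ℚP.*-identityˡ (toℚ k')))))
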